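{- Let $n,m\ge 2$ and suppose $\gamma_{2t}(K_n\Box K_m)<2\min\{n,m\}$. Let $V(K_n)=\{v_1,\dots,v_n\}$ and $V(K_m)=\{w_1,\dots,w_m\}$, and call the sets $\{v\}\times V(K_m)$ ($v\in V(K_n)$) rows and the sets $V(K_n)\times\{w\}$ ($w\in V(K_m)$) columns. Then for every total $2$-dominating set $S$ of $K_n\Box K_m$ with $|S|=\gamma_{2t}(K_n\Box K_m)$: (1) every row and every column contains at least one vertex of $S$; (2) there is a row containing at least three vertices of $S$, and there is a column containing at least three vertices of $S$.
   Context: $K_n$ denotes the complete graph on $n$ vertices. The Cartesian product $G\Box H$ has vertex set $V(G)\times V(H)$, with $(u_1,v_1)\sim(u_2,v_2)$ iff either $u_1=u_2$ and $v_1\sim v_2$, or $v_1=v_2$ and $u_1\sim u_2$. A set $S$ of vertices of a graph $G$ is total $2$-dominating if every vertex of $G$ (including those in $S$) is adjacent to at least two vertices of $S$; $\gamma_{2t}(G)$ is the minimum cardinality of such a set. (Equivalently, a minimum total $2$-dominating set of $K_n\Box K_m$ is a placement of the minimum number of rooks on an $n\times m$ board so that every cell is attacked by at least two rooks, a rook not attacking its own cell.) -}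

module Defs where

open import Data.Nat using (ℕ; zero; suc; _+_; _*_; _≤_; _⊓_)
open import Data.Fin using (Fin)
open import Data.Bool using (Bool; true; false; if_then_else_)
open import Data.Product using (_×_; ∃; ∃-syntax; _,_)
open import Data.Sum using (_⊎_)
open import Relation.Binary.PropositionalEquality using (_≡_; _≢_)
open import Relation.Nullary using (¬_)

Vertex : ℕ → ℕ → Set
Vertex n m = Fin n × Fin m

Adj : ∀ {n m} → Vertex n m → Vertex n m → Set
Adj (i , j) (i' , j') = (i ≡ i' × j ≢ j') ⊎ (j ≡ j' × i ≢ i')

VSet : ℕ → ℕ → Set
VSet n m = Fin n → Fin m → Bool

_∈S_ : ∀ {n m} → Vertex n m → VSet n m → Set
(i , j) ∈S S = S i j ≡ true

∑ : ∀ {k} → (Fin k → ℕ) → ℕ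
∑ {zero}  f = 0
∑ {suc k} f = f Fin.zero + ∑ (λ x → f (Fin.suc x))

ind : Bool → ℕ
ind b = if b then 1 else 0

card : ∀ {n m} → VSet n m → ℕ
card S = ∑ (λ i → ∑ (λ j → ind (S i j)))

-- number of vertices of S in row i ( = {v_i} × V(K_m) ) and column j
rowCount : ∀ {n m} → VSet n m → Fin n → ℕ
rowCount S i = ∑ (λ j → ind (S i j))

colCount : ∀ {n m} → VSet n m → Fin m → ℕ
colCount S j = ∑ (λ i → ind (S i j))

Total2Dom : ∀ {n m} → VSet n m → Set
Total2Dom {n} {m} S = ∀ (v : Vertex n m) →
  ∃[ u₁ ] ∃[ u₂ ] (u₁ ≢ u₂ × u₁ ∈S S × u₂ ∈S S × Adj v u₁ × Adj v u₂)

-- S is a minimum total 2-dominating set, i.e. card S = γ_{2t}(K_n □ K_m)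
IsMinT2D : ∀ {n m} → VSet n m → Set
IsMinT2D {n} {m} S = Total2Dom S × (∀ (T : VSet n m) → Total2Dom T → card S ≤ card T)

-- A vertex (i , j) is dominated by neighbours in its row and its column. If row i of S
-- contains no vertex outside column j, both dominators of (i , j) lie in column j. Hence an
-- empty row forces two vertices of S into every column, so |S| ≥ 2m; and when |S| < 2n some
-- row holds a single vertex (i , j) of S, whose column then holds it and its two dominators.
-- Transposing the board exchanges rows and columns.
module Submission where

open import Defs
open import Data.Nat using (ℕ; zero; suc; _+_; _*_; _≤_; _<_; _⊓_; z≤n; s≤s; _≤?_)
open import Data.Nat.Properties
  using ( +-0-commutativeMonoid; +-mono-≤; <⇒≱; ≰⇒>; ≤-trans; <-≤-trans; ≤-reflexive
        ; *-comm; *-monoʳ-≤; m⊓n≤m; m⊓n≤n)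
open import Data.Fin using (Fin; punchIn; punchOut) renaming (_≟_ to _≟ᶠ_)
open import Data.Fin.Properties using (punchIn-punchOut; punchOut-injective; ¬∀⟶∃¬)
open import Data.Bool using (Bool; true; false)
open import Data.Product using (_×_; ∃-syntax; ∃₂; _,_)
import Data.Product as Product
import Data.Sum as Sum
open import Data.Sum using (inj₁; inj₂)
open import Data.Empty using (⊥-elim)
open import Relation.Nullary using (yes; no)
open import Relation.Binary.PropositionalEquality
open import Algebra.Properties.CommutativeMonoid.Sum +-0-commutativeMonoid
  using (sum; sum-cong-≗; sum-remove; ∑-comm)

∑≡sum : ∀ {k} (f : Fin k → ℕ) → ∑ f ≡ sum f
∑≡sum {zero}  f = refl
∑≡sum {suc k} f = cong (f Fin.zero +_) (∑≡sum (λ x → f (Fin.suc x)))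

∑-remove : ∀ {k} (f : Fin (suc k) → ℕ) (x : Fin (suc k)) →
  ∑ f ≡ f x + ∑ (λ y → f (punchIn x y))
∑-remove f x = begin
  ∑ f                               ≡⟨ ∑≡sum f ⟩
  sum f                             ≡⟨ sum-remove {i = x} f ⟩
  f x + sum (λ y → f (punchIn x y)) ≡⟨ cong (f x +_) (∑≡sum (λ y → f (punchIn x y))) ⟨
  f x + ∑ (λ y → f (punchIn x y))   ∎
  where open ≡-Reasoning

∑-swap : ∀ {n m} (f : Fin n → Fin m → ℕ) →
  ∑ (λ i → ∑ (f i)) ≡ ∑ (λ j → ∑ (λ i → f i j))
∑-swap f = begin
  ∑ (λ i → ∑ (f i))              ≡⟨ ∑≡sum (λ i → ∑ (f i)) ⟩
  sum (λ i → ∑ (f i))            ≡⟨ sum-cong-≗ (λ i → ∑≡sum (f i)) ⟩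
  sum (λ i → sum (f i))          ≡⟨ ∑-comm f ⟩
  sum (λ j → sum (λ i → f i j))  ≡⟨ sum-cong-≗ (λ j → ∑≡sum (λ i → f i j)) ⟨
  sum (λ j → ∑ (λ i → f i j))    ≡⟨ ∑≡sum (λ j → ∑ (λ i → f i j)) ⟨
  ∑ (λ j → ∑ (λ i → f i j))      ∎
  where open ≡-Reasoning

∑-lower-bound : ∀ {n} k (f : Fin n → ℕ) → (∀ i → k ≤ f i) → n * k ≤ ∑ f
∑-lower-bound {zero}  k f k≤f = z≤n
∑-lower-bound {suc n} k f k≤f =
  +-mono-≤ (k≤f Fin.zero) (∑-lower-bound k (λ i → f (Fin.suc i)) (λ i → k≤f (Fin.suc i)))

pigeonhole : ∀ {n} k (f : Fin n → ℕ) → ∑ f < n * k → ∃[ i ] f i < k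
pigeonhole {n} k f ∑f<nk with ¬∀⟶∃¬ n (λ i → k ≤ f i) (λ i → k ≤? f i)
                                  (λ k≤f → <⇒≱ ∑f<nk (∑-lower-bound k f k≤f))
... | i , k≰fi = i , ≰⇒> k≰fi

count : ∀ {k} → (Fin k → Bool) → ℕ
count g = ∑ (λ x → ind (g x))

1≤count : ∀ {k} (g : Fin k → Bool) (x : Fin k) → g x ≡ true → 1 ≤ count g
1≤count {suc k} g x gx rewrite ∑-remove (λ y → ind (g y)) x | gx = s≤s z≤n

2≤count : ∀ {k} (g : Fin k → Bool) (x y : Fin k) → x ≢ y →
  g x ≡ true → g y ≡ true → 2 ≤ count g
2≤count {suc k} g x y x≢y gx gy rewrite ∑-remove (λ y → ind (g y)) x | gx =
  s≤s (1≤count (λ z → g (punchIn x z)) (punchOut x≢y)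
        (trans (cong g (punchIn-punchOut x≢y)) gy))

3≤count : ∀ {k} (g : Fin k → Bool) (x y z : Fin k) → x ≢ y → x ≢ z → y ≢ z →
  g x ≡ true → g y ≡ true → g z ≡ true → 3 ≤ count g
3≤count {suc k} g x y z x≢y x≢z y≢z gx gy gz rewrite ∑-remove (λ y → ind (g y)) x | gx =
  s≤s (2≤count (λ w → g (punchIn x w)) (punchOut x≢y) (punchOut x≢z)
        (λ e → y≢z (punchOut-injective x≢y x≢z e))
        (trans (cong g (punchIn-punchOut x≢y)) gy)
        (trans (cong g (punchIn-punchOut x≢z)) gz))

1≤count⇒∃ : ∀ {k} (g : Fin k → Bool) → 1 ≤ count g → ∃[ x ] g x ≡ true
1≤count⇒∃ {suc k} g 1≤c with g Fin.zero in g0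
... | true = Fin.zero , g0
... | false with 1≤count⇒∃ (λ y → g (Fin.suc y)) 1≤c
...   | x , gx = Fin.suc x , gx

transpose : ∀ {n m} → VSet n m → VSet m n
transpose S j i = S i j

card-transpose : ∀ {n m} (S : VSet n m) → card (transpose S) ≡ card S
card-transpose S = sym (∑-swap (λ i j → ind (S i j)))

Total2Dom-transpose : ∀ {n m} {S : VSet n m} → Total2Dom S → Total2Dom (transpose S)
Total2Dom-transpose dom (j , i) with dom (i , j)
... | u₁ , u₂ , u₁≢u₂ , u₁∈S , u₂∈S , adj₁ , adj₂ =
  Product.swap u₁ , Product.swap u₂ , (λ e → u₁≢u₂ (cong Product.swap e)) ,
  u₁∈S , u₂∈S , Sum.swap adj₁ , Sum.swap adj₂

module _ {n m} {S : VSet n m} (dom : Total2Dom S) where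

  column-dominators : ∀ i j → (∀ b → S i b ≡ true → b ≡ j) →
    ∃₂ λ a₁ a₂ → a₁ ≢ a₂ × i ≢ a₁ × i ≢ a₂ × S a₁ j ≡ true × S a₂ j ≡ true
  column-dominators i j row⊆j with dom (i , j)
  ... | (a₁ , b₁) , (a₂ , b₂) , u₁≢u₂ , s₁ , s₂ , adj₁ , adj₂
    with in-column adj₁ s₁ | in-column adj₂ s₂
    where
    in-column : ∀ {a b} → Adj (i , j) (a , b) → S a b ≡ true → b ≡ j × i ≢ a
    in-column (inj₁ (refl , j≢b)) s = ⊥-elim (j≢b (sym (row⊆j _ s)))
    in-column (inj₂ (refl , i≢a)) s = refl , i≢a
  ... | refl , i≢a₁ | refl , i≢a₂ =
    a₁ , a₂ , (λ { refl → u₁≢u₂ refl }) , i≢a₁ , i≢a₂ , s₁ , s₂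

  rows-nonempty : card S < m * 2 → ∀ i → 1 ≤ rowCount S i
  rows-nonempty |S|<2m i with 1 ≤? rowCount S i
  ... | yes 1≤row = 1≤row
  ... | no row-empty = ⊥-elim (<⇒≱ |S|<2m (begin
      m * 2                ≤⟨ ∑-lower-bound 2 (colCount S) two-per-column ⟩
      card (transpose S)   ≡⟨ card-transpose S ⟩
      card S               ∎))
    where
    open Data.Nat.Properties.≤-Reasoning
    two-per-column : ∀ j → 2 ≤ colCount S j
    two-per-column j with column-dominators i j (λ b s → ⊥-elim (row-empty (1≤count (S i) b s)))
    ... | a₁ , a₂ , a₁≢a₂ , _ , _ , s₁ , s₂ = 2≤count (λ a → S a j) a₁ a₂ a₁≢a₂ s₁ s₂

  column-with-three : card S < n * 2 → (∀ i → 1 ≤ rowCount S i) → ∃[ j ] 3 ≤ colCount S j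
  column-with-three |S|<2n rows≥1 with pigeonhole 2 (rowCount S) |S|<2n
  ... | i , row<2 with 1≤count⇒∃ (S i) (rows≥1 i)
  ...   | j , sij with column-dominators i j row⊆j
    where
    row⊆j : ∀ b → S i b ≡ true → b ≡ j
    row⊆j b sib with b ≟ᶠ j
    ... | yes b≡j = b≡j
    ... | no b≢j = ⊥-elim (<⇒≱ row<2 (2≤count (S i) b j b≢j sib sij))
  ...     | a₁ , a₂ , a₁≢a₂ , i≢a₁ , i≢a₂ , s₁ , s₂ =
    j , 3≤count (λ a → S a j) i a₁ a₂ i≢a₁ i≢a₂ a₁≢a₂ sij s₁ s₂

lemma2p3 : ∀ (n m : ℕ) → 2 ≤ n → 2 ≤ m →
    (S : VSet n m) → IsMinT2D S →
    card S < 2 * (n ⊓ m) →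
    ((∀ (i : Fin n) → 1 ≤ rowCount S i) × (∀ (j : Fin m) → 1 ≤ colCount S j))
    × ((∃[ i ] 3 ≤ rowCount S i) × (∃[ j ] 3 ≤ colCount S j))
lemma2p3 n m _ _ S (dom , _) |S|<2min = (rows≥1 , cols≥1) , (row≥3 , col≥3)
  where
  domᵀ : Total2Dom (transpose S)
  domᵀ = Total2Dom-transpose dom

  |S|<2n : card S < n * 2
  |S|<2n = <-≤-trans |S|<2min (≤-trans (*-monoʳ-≤ 2 (m⊓n≤m n m)) (≤-reflexive (*-comm 2 n)))

  |S|<2m : card S < m * 2
  |S|<2m = <-≤-trans |S|<2min (≤-trans (*-monoʳ-≤ 2 (m⊓n≤n n m)) (≤-reflexive (*-comm 2 m)))

  |Sᵀ|<2n : card (transpose S) < n * 2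
  |Sᵀ|<2n = subst (_< n * 2) (sym (card-transpose S)) |S|<2n

  |Sᵀ|<2m : card (transpose S) < m * 2
  |Sᵀ|<2m = subst (_< m * 2) (sym (card-transpose S)) |S|<2m

  rows≥1 : ∀ i → 1 ≤ rowCount S i
  rows≥1 = rows-nonempty dom |S|<2m

  cols≥1 : ∀ j → 1 ≤ colCount S j
  cols≥1 = rows-nonempty domᵀ |Sᵀ|<2n

  col≥3 : ∃[ j ] 3 ≤ colCount S j
  col≥3 = column-with-three dom |S|<2n rows≥1

  row≥3 : ∃[ i ] 3 ≤ rowCount S i
  row≥3 = column-with-three domᵀ |Sᵀ|<2m cols≥1
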